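{- Let $\mathcal{K}$ be a class of valuations, $x$ a variable and $w$ a term. If $\mathcal{K}\models w=w[w/x]$ and $\mathcal{K}[w/x]\subseteq\mathcal{K}$, then $\mathcal{K}_{x=w}=\mathcal{K}[w/x]$. Consequently, for all terms $t,u$: $\mathcal{K}_{x=w}\models t=u$ if and only if $\mathcal{K}\models t[w/x]=u[w/x]$.
   Context: Terms are built from a set of variables using constants $\mathrm{I}$, $0$, binary operations $;$, $+$ and unary operations ${}^{\smile}$, ${}^*$, ${}^{ - }$. An algebra for this signature is a nonempty set with operations of the corresponding arities; a valuation $v$ of such an algebra maps variables to elements, and $\hat v$ is its unique homomorphic extension to terms. A class of valuations may contain valuations of different algebras. $\mathcal{K}\models t=u$ means $\hat v(t)=\hat v(u)$ for every $v\in\mathcal{K}$; $\mathcal{K}_{x=w}=\{v\in\mathcal{K}:\hat v(x)=\hat v(w)\}$. $t[w/x]$ denotes $t$ with every occurrence of $x$ replaced by $w$. For a valuation $v$, $v[w/x]$ is the valuation (of the same algebra) with $v[w/x](x)=\hat v(w)$ and $v[w/x](y)=v(y)$ for $y\neq x$; $\mathcal{K}[w/x]=\{v[w/x]:v\in\mathcal{K}\}$. -}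

module Defs where

open import Level using (Level; suc; _⊔_; Lift)
open import Data.Nat using (ℕ; _≟_)
open import Data.Product using (Σ; ∃; _×_; _,_; proj₁; proj₂)
open import Relation.Nullary using (yes; no)
open import Relation.Binary.PropositionalEquality using (_≡_; subst)

Var : Set
Var = ℕ

data Term : Set where
  var  : Var → Term
  I𝕋   : Term
  0𝕋   : Term
  _⨾_  : Term → Term → Term
  _⊕_  : Term → Term → Term
  _˘   : Term → Term
  _⋆   : Term → Term
  _⁻   : Term → Term

record Algebra : Set₁ where
  field
    Carrier : Set
    inhabitant : Carrier
    I   : Carrier
    O   : Carrier
    seq : Carrier → Carrier → Carrier
    sum : Carrier → Carrier → Carrier
    cnv : Carrier → Carrier
    str : Carrier → Carrier
    cmp : Carrier → Carrier

record Valuation : Set₁ where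
  constructor val
  field
    alg : Algebra
    env : Var → Algebra.Carrier alg

open Valuation public

_≗ᵥ_ : Valuation → Valuation → Set₁
v ≗ᵥ v′ = Σ (alg v ≡ alg v′) λ p →
  ∀ y → subst Algebra.Carrier p (env v y) ≡ env v′ y

⟦_⟧ : (v : Valuation) → Term → Algebra.Carrier (alg v)
⟦ v ⟧ (var y)  = env v y
⟦ v ⟧ I𝕋       = Algebra.I (alg v)
⟦ v ⟧ 0𝕋       = Algebra.O (alg v)
⟦ v ⟧ (t ⨾ u)  = Algebra.seq (alg v) (⟦ v ⟧ t) (⟦ v ⟧ u)
⟦ v ⟧ (t ⊕ u)  = Algebra.sum (alg v) (⟦ v ⟧ t) (⟦ v ⟧ u)
⟦ v ⟧ (t ˘)    = Algebra.cnv (alg v) (⟦ v ⟧ t)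
⟦ v ⟧ (t ⋆)    = Algebra.str (alg v) (⟦ v ⟧ t)
⟦ v ⟧ (t ⁻)    = Algebra.cmp (alg v) (⟦ v ⟧ t)

Class : Set₂
Class = Valuation → Set₁

_∈_ : Valuation → Class → Set₁
v ∈ 𝒦 = 𝒦 v

_⊆_ : Class → Class → Set₁
𝒦 ⊆ 𝓛 = ∀ v → v ∈ 𝒦 → v ∈ 𝓛

_≐_ : Class → Class → Set₁
𝒦 ≐ 𝓛 = (𝒦 ⊆ 𝓛) × (𝓛 ⊆ 𝒦)

_⊨_≈_ : Class → Term → Term → Set₁
𝒦 ⊨ t ≈ u = ∀ v → v ∈ 𝒦 → ⟦ v ⟧ t ≡ ⟦ v ⟧ u

_[_/_] : Term → Term → Var → Term
var y [ w / x ] with y ≟ x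
... | yes _ = w
... | no  _ = var y
I𝕋 [ w / x ]      = I𝕋
0𝕋 [ w / x ]      = 0𝕋
(t ⨾ u) [ w / x ] = (t [ w / x ]) ⨾ (u [ w / x ])
(t ⊕ u) [ w / x ] = (t [ w / x ]) ⊕ (u [ w / x ])
(t ˘) [ w / x ]   = (t [ w / x ]) ˘
(t ⋆) [ w / x ]   = (t [ w / x ]) ⋆
(t ⁻) [ w / x ]   = (t [ w / x ]) ⁻

_⟪_/_⟫ : Valuation → Term → Var → Valuation
alg (v ⟪ w / x ⟫) = alg v
env (v ⟪ w / x ⟫) y with y ≟ x
... | yes _ = ⟦ v ⟧ w
... | no  _ = env v y

_∣_≔_ : Class → Var → Term → Class
(𝒦 ∣ x ≔ w) v = (v ∈ 𝒦) × Lift (suc Level.zero) (⟦ v ⟧ (var x) ≡ ⟦ v ⟧ w)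

_⟦_/_⟧ : Class → Term → Var → Class
-- Membership uses equality of valuations, i.e. same algebra and the same
-- map on variables (compared pointwise, as functions are equal extensionally).
(𝒦 ⟦ w / x ⟧) v′ = Σ Valuation λ v → (v ∈ 𝒦) × (v′ ≗ᵥ (v ⟪ w / x ⟫))

-- Evaluating a term under the updated valuation v[w/x] is the same as
-- evaluating t[w/x] under v, so an equation holds throughout 𝒦[w/x] exactly when
-- its substitution instance holds throughout 𝒦. A valuation with x ↦ v̂(w) is its
-- own update, which gives 𝒦_{x=w} ⊆ 𝒦[w/x]. Conversely every v[w/x] lies in 𝒦 by
-- closure and satisfies x = w, since x evaluates to v̂(w) = v̂(w[w/x]), which is
-- the value of w under v[w/x].
module Submission where

open import Defs
open import Data.Product using (_×_; _,_)
open import Function.Bundles using (_⇔_; mk⇔; Equivalence)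
open import Function.Construct.Composition using (_⇔-∘_)
open import Level using (lift)
open import Data.Nat using (_≟_)
open import Data.Nat.Properties using (≟-diag)
open import Relation.Nullary using (yes; no)
open import Relation.Binary.PropositionalEquality

⟦⟧-cong-env : (A : Algebra) {e e′ : Var → Algebra.Carrier A}
  → (∀ y → e y ≡ e′ y) → ∀ t → ⟦ val A e ⟧ t ≡ ⟦ val A e′ ⟧ t
⟦⟧-cong-env A e≗e′ (var y) = e≗e′ y
⟦⟧-cong-env A e≗e′ I𝕋      = refl
⟦⟧-cong-env A e≗e′ 0𝕋      = refl
⟦⟧-cong-env A e≗e′ (t ⨾ u) = cong₂ (Algebra.seq A) (⟦⟧-cong-env A e≗e′ t) (⟦⟧-cong-env A e≗e′ u)
⟦⟧-cong-env A e≗e′ (t ⊕ u) = cong₂ (Algebra.sum A) (⟦⟧-cong-env A e≗e′ t) (⟦⟧-cong-env A e≗e′ u)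
⟦⟧-cong-env A e≗e′ (t ˘)   = cong (Algebra.cnv A) (⟦⟧-cong-env A e≗e′ t)
⟦⟧-cong-env A e≗e′ (t ⋆)   = cong (Algebra.str A) (⟦⟧-cong-env A e≗e′ t)
⟦⟧-cong-env A e≗e′ (t ⁻)   = cong (Algebra.cmp A) (⟦⟧-cong-env A e≗e′ t)

-- The carriers of equal valuations are only propositionally equal, so values
-- cannot be compared directly; equations between values can.
≗ᵥ-reflects-≡ : ∀ {v v′} → v ≗ᵥ v′ → ∀ t u → ⟦ v′ ⟧ t ≡ ⟦ v′ ⟧ u → ⟦ v ⟧ t ≡ ⟦ v ⟧ u
≗ᵥ-reflects-≡ {val A e} (refl , e≗e′) t u eq = begin
  ⟦ val A e ⟧ t  ≡⟨ ⟦⟧-cong-env A e≗e′ t ⟩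
  _              ≡⟨ eq ⟩
  _              ≡⟨ ⟦⟧-cong-env A e≗e′ u ⟨
  ⟦ val A e ⟧ u  ∎
  where open ≡-Reasoning

⟦⟧-update : ∀ v w x t → ⟦ v ⟪ w / x ⟫ ⟧ t ≡ ⟦ v ⟧ (t [ w / x ])
⟦⟧-update v w x (var y) with y ≟ x
... | yes _ = refl
... | no  _ = refl
⟦⟧-update v w x I𝕋      = refl
⟦⟧-update v w x 0𝕋      = refl
⟦⟧-update v w x (t ⨾ u) = cong₂ (Algebra.seq (alg v)) (⟦⟧-update v w x t) (⟦⟧-update v w x u)
⟦⟧-update v w x (t ⊕ u) = cong₂ (Algebra.sum (alg v)) (⟦⟧-update v w x t) (⟦⟧-update v w x u)
⟦⟧-update v w x (t ˘)   = cong (Algebra.cnv (alg v)) (⟦⟧-update v w x t)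
⟦⟧-update v w x (t ⋆)   = cong (Algebra.str (alg v)) (⟦⟧-update v w x t)
⟦⟧-update v w x (t ⁻)   = cong (Algebra.cmp (alg v)) (⟦⟧-update v w x t)

var-[/]-self : ∀ w x → var x [ w / x ] ≡ w
var-[/]-self w x rewrite ≟-diag (refl {x = x}) = refl

update-self : ∀ v w x → ⟦ v ⟧ (var x) ≡ ⟦ v ⟧ w → v ≗ᵥ (v ⟪ w / x ⟫)
update-self v w x vx≡vw = refl , pointwise
  where
  pointwise : ∀ y → env v y ≡ env (v ⟪ w / x ⟫) y
  pointwise y with y ≟ x
  ... | yes refl = vx≡vw
  ... | no  _    = refl

⊨-image⇔⊨-[/] : ∀ 𝒦 w x t u → (𝒦 ⟦ w / x ⟧) ⊨ t ≈ u ⇔ 𝒦 ⊨ (t [ w / x ]) ≈ (u [ w / x ])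
⊨-image⇔⊨-[/] 𝒦 w x t u = mk⇔ to from
  where
  to : (𝒦 ⟦ w / x ⟧) ⊨ t ≈ u → 𝒦 ⊨ (t [ w / x ]) ≈ (u [ w / x ])
  to image⊨ v v∈𝒦 = begin
    ⟦ v ⟧ (t [ w / x ])    ≡⟨ ⟦⟧-update v w x t ⟨
    ⟦ v ⟪ w / x ⟫ ⟧ t      ≡⟨ image⊨ (v ⟪ w / x ⟫) (v , v∈𝒦 , refl , λ _ → refl) ⟩
    ⟦ v ⟪ w / x ⟫ ⟧ u      ≡⟨ ⟦⟧-update v w x u ⟩
    ⟦ v ⟧ (u [ w / x ])    ∎
    where open ≡-Reasoning
  from : 𝒦 ⊨ (t [ w / x ]) ≈ (u [ w / x ]) → (𝒦 ⟦ w / x ⟧) ⊨ t ≈ u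
  from 𝒦⊨ v′ (v , v∈𝒦 , v′≗) = ≗ᵥ-reflects-≡ v′≗ t u
    (trans (⟦⟧-update v w x t) (trans (𝒦⊨ v v∈𝒦) (sym (⟦⟧-update v w x u))))

⊨-cong-≐ : ∀ {𝒦 𝓛} → 𝒦 ≐ 𝓛 → ∀ t u → 𝒦 ⊨ t ≈ u ⇔ 𝓛 ⊨ t ≈ u
⊨-cong-≐ (𝒦⊆𝓛 , 𝓛⊆𝒦) t u = mk⇔
  (λ 𝒦⊨ v v∈𝓛 → 𝒦⊨ v (𝓛⊆𝒦 v v∈𝓛))
  (λ 𝓛⊨ v v∈𝒦 → 𝓛⊨ v (𝒦⊆𝓛 v v∈𝒦))

restrict⊆image : ∀ 𝒦 x w → (𝒦 ∣ x ≔ w) ⊆ (𝒦 ⟦ w / x ⟧)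
restrict⊆image 𝒦 x w v (v∈𝒦 , lift vx≡vw) = v , v∈𝒦 , update-self v w x vx≡vw

image⊆restrict : ∀ 𝒦 x w → 𝒦 ⊨ w ≈ (w [ w / x ]) → (𝒦 ⟦ w / x ⟧) ⊆ 𝒦
  → (𝒦 ⟦ w / x ⟧) ⊆ (𝒦 ∣ x ≔ w)
image⊆restrict 𝒦 x w w-fixed closed v′ v′∈image =
  closed v′ v′∈image , lift (Equivalence.from (⊨-image⇔⊨-[/] 𝒦 w x (var x) w) x≈w v′ v′∈image)
  where
  x≈w : 𝒦 ⊨ (var x [ w / x ]) ≈ (w [ w / x ])
  x≈w v v∈𝒦 = trans (cong ⟦ v ⟧ (var-[/]-self w x)) (w-fixed v v∈𝒦)

proposition17 : (𝒦 : Class) (x : Var) (w : Term)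
    → 𝒦 ⊨ w ≈ (w [ w / x ])
    → (𝒦 ⟦ w / x ⟧) ⊆ 𝒦
    → ((𝒦 ∣ x ≔ w) ≐ (𝒦 ⟦ w / x ⟧))
      × (∀ (t u : Term) → ((𝒦 ∣ x ≔ w) ⊨ t ≈ u) ⇔ (𝒦 ⊨ (t [ w / x ]) ≈ (u [ w / x ])))
proposition17 𝒦 x w w-fixed closed = restrict≐image , λ t u →
  ⊨-image⇔⊨-[/] 𝒦 w x t u ⇔-∘ ⊨-cong-≐ restrict≐image t u
  where
  restrict≐image : (𝒦 ∣ x ≔ w) ≐ (𝒦 ⟦ w / x ⟧)
  restrict≐image = restrict⊆image 𝒦 x w , image⊆restrict 𝒦 x w w-fixed closed
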